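{- Let $\rho$ be a positive integer that is a palindrome in base $10$ (i.e. $r(\rho)=\rho$) and whose decimal digits are all $0$'s and $1$'s. Then $18\rho$ is a $v$-palindrome.
   Context: For an integer $n\geq 1$, $r(n)$ denotes the number formed by writing the decimal digits of $n$ in reverse order. The function $v\colon\mathbb{N}\to\mathbb{Z}$ is the additive arithmetic function (i.e. $v(mn)=v(m)+v(n)$ whenever $\gcd(m,n)=1$, and $v(1)=0$) determined on prime powers by $v(p)=p$ and $v(p^\alpha)=p+\alpha$ for $\alpha\geq 2$. An integer $n\geq 1$ is a $v$-palindrome if $10\nmid n$, $n\neq r(n)$, and $v(n)=v(r(n))$. -}

module Defs where

open import Data.Nat using (ℕ; zero; suc; _+_; _*_; _≤_; _<_; _≤ᵇ_; NonZero)
open import Data.Nat.DivMod using (_/_; _%_)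
open import Data.Nat.Divisibility using (_∣_; _∣?_)
open import Data.Nat.Primality using (prime?)
open import Data.List using (List; []; _∷_; reverse; foldr; upTo)
open import Data.Bool using (Bool; true; false; if_then_else_)
open import Data.Product using (_×_)
open import Data.Integer using (ℤ; +_)
open import Relation.Nullary using (¬_; yes; no; does)
open import Relation.Binary.PropositionalEquality using (_≡_; _≢_)

-- Decimal digits of n, least significant first (digits 0 = []).
-- The fuel argument is ≥ the number of digits, so it never runs out.
digitsAux : ℕ → ℕ → List ℕ
digitsAux zero    n       = []
digitsAux (suc f) zero    = []
digitsAux (suc f) (suc n) = (suc n % 10) ∷ digitsAux f (suc n / 10)

digits : ℕ → List ℕ
digits n = digitsAux n n

fromDigits : List ℕ → ℕ
fromDigits []       = 0
fromDigits (d ∷ ds) = d + 10 * fromDigits ds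

r : ℕ → ℕ
r n = fromDigits (reverse (digits n))

-- Multiplicity of the prime p = k+2 in n (with fuel ≥ n).
multAux : ℕ → ℕ → ℕ → ℕ
multAux k zero    n       = 0
multAux k (suc f) zero    = 0
multAux k (suc f) (suc n) with suc (suc k) ∣? suc n
... | yes _ = suc (multAux k f (suc n / suc (suc k)))
... | no  _ = 0

mult : ℕ → ℕ → ℕ
mult zero          n = 0
mult (suc zero)    n = 0
mult (suc (suc k)) n = multAux k n n

vPrimePower : ℕ → ℕ → ℕ
vPrimePower p α = if α ≤ᵇ 1 then p else p + α

vTerm : ℕ → ℕ → ℕ
vTerm n p with does (prime? p) | does (p ∣? n)
... | true  | true = vPrimePower p (mult p n)
... | _     | _    = 0

-- v(n) = Σ_{p^α ∥ n} v(p^α): the additive function with v(p) = p and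
-- v(p^α) = p + α for α ≥ 2 (so v(1) = 0).  Primes dividing n ≥ 1 are ≤ n.
v : ℕ → ℤ
v n = + foldr (λ p acc → vTerm n p + acc) 0 (upTo (suc n))

IsVPalindrome : ℕ → Set
IsVPalindrome n = (¬ (10 ∣ n)) × (n ≢ r n) × (v n ≡ v (r n))

DigitsZeroOne : ℕ → Set
DigitsZeroOne n = AllList (λ d → (d ≡ 0) ⊎' (d ≡ 1)) (digits n)
  where
  open import Data.List.Relation.Unary.All renaming (All to AllList)
  open import Data.Sum renaming (_⊎_ to _⊎'_)

{-# OPTIONS --safe #-}
-- Because ρ has only digits 0 and 1, the digits of 18ρ = 10ρ + 8ρ are d(i-1) + 8 d(i) ≤ 9:
-- no carries occur, and read backwards they are the digits of ρ′ + 80ρ′ with ρ′ = r ρ = ρ,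
-- so r(18ρ) = 81ρ. The leading digit of ρ is 1, hence (ρ being a palindrome) so is its units
-- digit, and ρ is odd.
-- Now 18ρ = 2·3²·ρ and 81ρ = 3⁴·ρ: if 3^b ∥ ρ, the primes 2 and 3 contribute
-- 2 + (3 + (2 + b)) and 0 + (3 + (4 + b)) to v respectively, and every other prime
-- contributes equally to both.
module Submission where

open import Defs
open import Data.Nat using (ℕ; _*_; _≤_)
open import Relation.Binary.PropositionalEquality using (_≡_)

open import Level using (Level)
open import Data.Bool using (true; false)
import Data.Integer as ℤ
open import Data.List using (List; []; _∷_; _∷ʳ_; reverse; zipWith; length; applyUpTo; upTo; map; foldr; initLast; _∷ʳ′_)
open import Data.List.Properties using (unfold-reverse; reverse-++; length-++; length-reverse; foldr-map; map-upTo)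
open import Data.List.Relation.Unary.All using (All; []; _∷_)
open import Data.List.Relation.Unary.All.Properties using (∷ʳ⁻)
open import Data.Nat
open import Data.Nat.DivMod
open import Data.Nat.Divisibility
open import Data.Nat.Induction using (<-wellFounded)
open import Data.Nat.ListAction using (sum)
open import Data.Nat.Primality
open import Data.Nat.Properties
open import Data.Nat.Tactic.RingSolver using (solve-∀)
open import Data.Product using (_,_; ∃; proj₁; proj₂)
open import Data.Sum using (_⊎_; inj₁; inj₂; [_,_]′)
open import Function using (_∘_)
open import Induction.WellFounded using (Acc; acc)
open import Relation.Nullary using (¬_; Dec; yes; no; does; contradiction)
open import Relation.Nullary.Decidable using (dec-true; dec-false; from-yes; from-no)
open import Relation.Binary.PropositionalEquality
  using (_≢_; refl; sym; trans; cong; cong₂; subst; module ≡-Reasoning)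

open ≡-Reasoning

private
  variable
    ℓ₁ ℓ₂ ℓ₃ : Level

[d+10*x]%10≡d : ∀ {d} x → d < 10 → (d + 10 * x) % 10 ≡ d
[d+10*x]%10≡d {d} x d<10 = begin
  (d + 10 * x) % 10 ≡⟨ cong (λ t → (d + t) % 10) (*-comm 10 x) ⟩
  (d + x * 10) % 10 ≡⟨ [m+kn]%n≡m%n d x 10 ⟩
  d % 10            ≡⟨ m<n⇒m%n≡m d<10 ⟩
  d                 ∎

[d+10*x]/10≡x : ∀ {d} x → d < 10 → (d + 10 * x) / 10 ≡ x
[d+10*x]/10≡x {d} x d<10 = begin
  (d + 10 * x) / 10    ≡⟨ +-distrib-/-∣ʳ d (m∣m*n x) ⟩
  d / 10 + 10 * x / 10 ≡⟨ cong₂ _+_ (m<n⇒m/n≡0 d<10) (cong (_/ 10) (*-comm 10 x)) ⟩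
  x * 10 / 10          ≡⟨ m*n/n≡m x 10 ⟩
  x                    ∎

[1+n]/10≤n : ∀ n → suc n / 10 ≤ n
[1+n]/10≤n n = <⇒≤pred (m/n<m (suc n) 10 (s≤s (s≤s z≤n)))

fromDigits-digitsAux : ∀ {f} n → n ≤ f → fromDigits (digitsAux f n) ≡ n
fromDigits-digitsAux {zero}  zero    _         = refl
fromDigits-digitsAux {suc f} zero    _         = refl
fromDigits-digitsAux {suc f} (suc n) (s≤s n≤f) = begin
  suc n % 10 + 10 * fromDigits (digitsAux f (suc n / 10))
    ≡⟨ cong (λ t → suc n % 10 + 10 * t) (fromDigits-digitsAux (suc n / 10) (≤-trans ([1+n]/10≤n n) n≤f)) ⟩
  suc n % 10 + 10 * (suc n / 10) ≡⟨ cong ((suc n % 10) +_) (*-comm 10 (suc n / 10)) ⟩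
  suc n % 10 + suc n / 10 * 10   ≡⟨ m≡m%n+[m/n]*n (suc n) 10 ⟨
  suc n                          ∎

fromDigits-digits : ∀ n → fromDigits (digits n) ≡ n
fromDigits-digits n = fromDigits-digitsAux n ≤-refl

-- Digit lists are least significant first, so positivity of every suffix forbids
-- a zero most significant digit.
data Canonical : List ℕ → Set where
  []   : Canonical []
  cons : ∀ {d ds} → d < 10 → Canonical ds → 0 < fromDigits (d ∷ ds) → Canonical (d ∷ ds)

digitsAux-canonical : ∀ {f} n → n ≤ f → Canonical (digitsAux f n)
digitsAux-canonical {zero}  zero    _         = []
digitsAux-canonical {suc f} zero    _         = []
digitsAux-canonical {suc f} (suc n) (s≤s n≤f) =
  cons (m%n<n (suc n) 10)
       (digitsAux-canonical (suc n / 10) (≤-trans ([1+n]/10≤n n) n≤f))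
       (subst (0 <_) (sym (fromDigits-digitsAux {suc f} (suc n) (s≤s n≤f))) z<s)

digits-canonical : ∀ n → Canonical (digits n)
digits-canonical n = digitsAux-canonical n ≤-refl

x<d+10*x : ∀ d x → 0 < d + 10 * x → x < d + 10 * x
x<d+10*x d zero    0<d   = 0<d
x<d+10*x d (suc x) _     = ≤-trans (m<m*n (suc x) 10 (s≤s (s≤s z≤n)))
                                   (≤-trans (≤-reflexive (*-comm (suc x) 10)) (m≤n+m _ d))

digitsAux-fromDigits : ∀ {f ds} → Canonical ds → fromDigits ds ≤ f → digitsAux f (fromDigits ds) ≡ ds
digitsAux-fromDigits {zero}  []                 _  = refl
digitsAux-fromDigits {suc f} []                 _  = refl
digitsAux-fromDigits {zero}  (cons _ _ 0<n)     n≤0 = contradiction (≤-trans 0<n n≤0) λ ()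
digitsAux-fromDigits {suc f} {d ∷ ds} (cons d<10 c 0<n) n≤1+f = begin
  digitsAux (suc f) (d + 10 * x)                      ≡⟨ digitsAux-suc 0<n ⟩
  (d + 10 * x) % 10 ∷ digitsAux f ((d + 10 * x) / 10) ≡⟨ cong₂ (λ a b → a ∷ digitsAux f b)
                                                           ([d+10*x]%10≡d x d<10) ([d+10*x]/10≡x x d<10) ⟩
  d ∷ digitsAux f x                                   ≡⟨ cong (d ∷_) (digitsAux-fromDigits c x≤f) ⟩
  d ∷ ds                                              ∎
  where
  x = fromDigits ds
  x≤f : x ≤ f
  x≤f = ≤-pred (≤-trans (x<d+10*x d x 0<n) n≤1+f)
  digitsAux-suc : ∀ {n} → 0 < n → digitsAux (suc f) n ≡ n % 10 ∷ digitsAux f (n / 10)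
  digitsAux-suc {suc n} _ = refl

digits-fromDigits : ∀ {ds} → Canonical ds → digits (fromDigits ds) ≡ ds
digits-fromDigits c = digitsAux-fromDigits c ≤-refl

canonical-∷ʳ⇒last>0 : ∀ xs {x} → Canonical (xs ∷ʳ x) → 0 < x
canonical-∷ʳ⇒last>0 []       {suc x} _            = z<s
canonical-∷ʳ⇒last>0 []       {zero}  (cons _ _ ())
canonical-∷ʳ⇒last>0 (_ ∷ xs)         (cons _ c _) = canonical-∷ʳ⇒last>0 xs c

module _ {A : Set ℓ₁} {B : Set ℓ₂} {C : Set ℓ₃} (f : A → B → C) where

  zipWith-∷ʳ : ∀ xs ys {x y} → length xs ≡ length ys →
               zipWith f (xs ∷ʳ x) (ys ∷ʳ y) ≡ zipWith f xs ys ∷ʳ f x y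
  zipWith-∷ʳ []       []       _   = refl
  zipWith-∷ʳ (a ∷ xs) (b ∷ ys) len = cong (f a b ∷_) (zipWith-∷ʳ xs ys (suc-injective len))

  reverse-zipWith : ∀ xs ys → length xs ≡ length ys →
                    reverse (zipWith f xs ys) ≡ zipWith f (reverse xs) (reverse ys)
  reverse-zipWith []       []       _   = refl
  reverse-zipWith (a ∷ xs) (b ∷ ys) len = begin
    reverse (f a b ∷ zipWith f xs ys)               ≡⟨ unfold-reverse (f a b) (zipWith f xs ys) ⟩
    reverse (zipWith f xs ys) ∷ʳ f a b              ≡⟨ cong (_∷ʳ f a b) (reverse-zipWith xs ys len′) ⟩
    zipWith f (reverse xs) (reverse ys) ∷ʳ f a b    ≡⟨ zipWith-∷ʳ (reverse xs) (reverse ys) len-rev ⟨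
    zipWith f (reverse xs ∷ʳ a) (reverse ys ∷ʳ b)   ≡⟨ cong₂ (zipWith f) (unfold-reverse a xs) (unfold-reverse b ys) ⟨
    zipWith f (reverse (a ∷ xs)) (reverse (b ∷ ys)) ∎
    where
    len′ = suc-injective len
    len-rev = trans (length-reverse xs) (trans len′ (sym (length-reverse ys)))

length-∷ʳ : ∀ {A : Set ℓ₁} (xs : List A) {x} → length (xs ∷ʳ x) ≡ suc (length xs)
length-∷ʳ xs = trans (length-++ xs) (+-comm (length xs) 1)

fromDigits-∷ʳ0 : ∀ ds → fromDigits (ds ∷ʳ 0) ≡ fromDigits ds
fromDigits-∷ʳ0 []       = refl
fromDigits-∷ʳ0 (d ∷ ds) = cong (λ t → d + 10 * t) (fromDigits-∷ʳ0 ds)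

fromDigits-zipWith : ∀ c xs ys → length xs ≡ length ys →
  fromDigits (zipWith (λ a b → a + c * b) xs ys) ≡ fromDigits xs + c * fromDigits ys
fromDigits-zipWith c []       []       _   = sym (*-zeroʳ c)
fromDigits-zipWith c (a ∷ xs) (b ∷ ys) len = begin
  (a + c * b) + 10 * fromDigits (zipWith _ xs ys)
    ≡⟨ cong (λ t → (a + c * b) + 10 * t) (fromDigits-zipWith c xs ys (suc-injective len)) ⟩
  (a + c * b) + 10 * (fromDigits xs + c * fromDigits ys)
    ≡⟨ regroup a b c (fromDigits xs) (fromDigits ys) ⟩
  (a + 10 * fromDigits xs) + c * (b + 10 * fromDigits ys) ∎
  where
  regroup : ∀ a b c x y → (a + c * b) + 10 * (x + c * y) ≡ (a + 10 * x) + c * (b + 10 * y)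
  regroup = solve-∀

Bit : ℕ → Set
Bit d = (d ≡ 0) ⊎ (d ≡ 1)

bit≤1 : ∀ {d} → Bit d → d ≤ 1
bit≤1 (inj₁ refl) = z≤n
bit≤1 (inj₂ refl) = ≤-refl

-- The digits of 18n = 10n + 8n when the digits of n are 0 or 1 (then no carries occur).
×18-digits : List ℕ → List ℕ
×18-digits ds = zipWith (λ a b → a + 8 * b) (0 ∷ ds) (ds ∷ʳ 0)

fromDigits-×18-digits : ∀ ds → fromDigits (×18-digits ds) ≡ 18 * fromDigits ds
fromDigits-×18-digits ds = begin
  fromDigits (×18-digits ds)                    ≡⟨ fromDigits-zipWith 8 (0 ∷ ds) (ds ∷ʳ 0) (sym (length-∷ʳ ds)) ⟩
  10 * fromDigits ds + 8 * fromDigits (ds ∷ʳ 0) ≡⟨ cong (λ t → 10 * fromDigits ds + 8 * t) (fromDigits-∷ʳ0 ds) ⟩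
  10 * fromDigits ds + 8 * fromDigits ds        ≡⟨ *-distribʳ-+ (fromDigits ds) 10 8 ⟨
  18 * fromDigits ds                            ∎

fromDigits-reverse-×18-digits : ∀ ds → fromDigits (reverse (×18-digits ds)) ≡ 81 * fromDigits (reverse ds)
fromDigits-reverse-×18-digits ds = begin
  fromDigits (reverse (×18-digits ds))
    ≡⟨ cong fromDigits (reverse-zipWith _ (0 ∷ ds) (ds ∷ʳ 0) (sym (length-∷ʳ ds))) ⟩
  fromDigits (zipWith _ (reverse (0 ∷ ds)) (reverse (ds ∷ʳ 0)))
    ≡⟨ cong₂ (λ xs ys → fromDigits (zipWith _ xs ys)) (unfold-reverse 0 ds) (reverse-++ ds (0 ∷ [])) ⟩
  fromDigits (zipWith _ (rs ∷ʳ 0) (0 ∷ rs))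
    ≡⟨ fromDigits-zipWith 8 (rs ∷ʳ 0) (0 ∷ rs) (length-∷ʳ rs) ⟩
  fromDigits (rs ∷ʳ 0) + 8 * (10 * fromDigits rs)
    ≡⟨ cong₂ _+_ (fromDigits-∷ʳ0 rs) (sym (*-assoc 8 10 (fromDigits rs))) ⟩
  81 * fromDigits rs ∎
  where rs = reverse ds

×18-canonical : ∀ {p ds} → Bit p → All Bit ds → Canonical (p ∷ ds) →
  Canonical (zipWith (λ a b → a + 8 * b) (p ∷ ds) (ds ∷ʳ 0))
×18-canonical (inj₁ refl) []         (cons _ _ ())
×18-canonical (inj₂ refl) []         _              = cons (s≤s (s≤s z≤n)) [] z<s
×18-canonical {p} {d ∷ ds} bp (bd ∷ bds) (cons _ c 0<n) =
  cons (s≤s (+-mono-≤ (bit≤1 bp) (*-monoʳ-≤ 8 (bit≤1 bd))))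
       (×18-canonical bd bds c)
       (subst (0 <_) (sym (fromDigits-zipWith 8 (p ∷ d ∷ ds) ((d ∷ ds) ∷ʳ 0) (sym (length-∷ʳ (d ∷ ds)))))
              (≤-trans 0<n (m≤m+n _ _)))

digits-18* : ∀ {n} → 0 < n → DigitsZeroOne n → digits (18 * n) ≡ ×18-digits (digits n)
digits-18* {n} 0<n bits = begin
  digits (18 * n)                     ≡⟨ cong digits (trans (fromDigits-×18-digits ds) (cong (18 *_) (fromDigits-digits n))) ⟨
  digits (fromDigits (×18-digits ds)) ≡⟨ digits-fromDigits canonical ⟩
  ×18-digits ds                       ∎
  where
  ds = digits n
  0<10n : 0 < fromDigits (0 ∷ ds)
  0<10n = subst (λ m → 0 < 10 * m) (sym (fromDigits-digits n)) (≤-trans 0<n (m≤n*m n 10))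
  canonical : Canonical (×18-digits ds)
  canonical = ×18-canonical (inj₁ refl) bits (cons z<s (digits-canonical n) 0<10n)

r-18* : ∀ n → DigitsZeroOne n → r (18 * n) ≡ 81 * r n
r-18* zero      _    = refl
r-18* n@(suc _) bits = begin
  fromDigits (reverse (digits (18 * n)))       ≡⟨ cong (fromDigits ∘ reverse) (digits-18* z<s bits) ⟩
  fromDigits (reverse (×18-digits (digits n))) ≡⟨ fromDigits-reverse-×18-digits (digits n) ⟩
  81 * r n                                     ∎

fromDigits-reverse≡1+10* : ∀ ds → Canonical ds → All Bit ds → 0 < fromDigits ds →
  ∃ λ q → fromDigits (reverse ds) ≡ 1 + 10 * q
fromDigits-reverse≡1+10* ds c bits 0<n with initLast ds
fromDigits-reverse≡1+10* .[] c bits () | []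
fromDigits-reverse≡1+10* .(xs ∷ʳ x) c bits 0<n | xs ∷ʳ′ x
  with proj₂ (∷ʳ⁻ bits) | canonical-∷ʳ⇒last>0 xs c
... | inj₁ refl | ()
... | inj₂ refl | _ = fromDigits (reverse xs) , cong fromDigits (reverse-++ xs (1 ∷ []))

-- The units digit of r n is the leading digit of n.
r≡1+10* : ∀ {n} → 0 < n → DigitsZeroOne n → ∃ λ q → r n ≡ 1 + 10 * q
r≡1+10* {n} 0<n bits =
  fromDigits-reverse≡1+10* (digits n) (digits-canonical n) bits (subst (0 <_) (sym (fromDigits-digits n)) 0<n)

multAux-fuel : ∀ k {f g} n → n ≤ f → n ≤ g → multAux k f n ≡ multAux k g n
multAux-fuel k {zero}  {zero}  zero    _         _         = refl
multAux-fuel k {zero}  {suc g} zero    _         _         = refl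
multAux-fuel k {suc f} {zero}  zero    _         _         = refl
multAux-fuel k {suc f} {suc g} zero    _         _         = refl
multAux-fuel k {suc f} {suc g} (suc n) (s≤s n≤f) (s≤s n≤g) with suc (suc k) ∣? suc n
... | yes _ = cong suc (multAux-fuel k (suc n / suc (suc k)) (≤-trans shrink n≤f) (≤-trans shrink n≤g))
  where shrink = <⇒≤pred (m/n<m (suc n) (suc (suc k)) (s≤s (s≤s z≤n)))
... | no  _ = refl

mult-∤ : ∀ p .{{_ : NonTrivial p}} {n} → ¬ p ∣ n → mult p n ≡ 0
mult-∤ (suc (suc k)) {zero}  p∤n = contradiction (_ ∣0) p∤n
mult-∤ (suc (suc k)) {suc n} p∤n with suc (suc k) ∣? suc n
... | yes p∣n = contradiction p∣n p∤n
... | no  _   = refl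

mult-p* : ∀ p .{{_ : NonTrivial p}} n .{{_ : NonZero n}} → mult p (p * n) ≡ suc (mult p n)
mult-p* (suc (suc k)) (suc n) with suc (suc k) ∣? suc (n + suc k * suc n)
... | no  p∤pn = contradiction (m∣m*n (suc n)) p∤pn
... | yes _    = cong suc (begin
  multAux k f (p * suc n / p) ≡⟨ cong (multAux k f) (trans (cong (_/ p) (*-comm p (suc n))) (m*n/n≡m (suc n) p)) ⟩
  multAux k f (suc n)         ≡⟨ multAux-fuel k {f} (suc n) fuel ≤-refl ⟩
  multAux k (suc n) (suc n)   ∎)
  where
  p = suc (suc k)
  f = n + suc k * suc n
  fuel : suc n ≤ f
  fuel = ≤-trans (m≤m+n (suc n) (k * suc n)) (m≤n+m _ n)

mult-^* : ∀ p .{{_ : NonTrivial p}} a n .{{_ : NonZero n}} → mult p (p ^ a * n) ≡ a + mult p n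
mult-^* p zero    n = cong (mult p) (*-identityˡ n)
mult-^* p (suc a) n = begin
  mult p (p * p ^ a * n)   ≡⟨ cong (mult p) (*-assoc p (p ^ a) n) ⟩
  mult p (p * (p ^ a * n)) ≡⟨ mult-p* p (p ^ a * n) {{m*n≢0 (p ^ a) n {{m^n≢0 p a {{nonTrivial⇒nonZero p}}}}}} ⟩
  suc (mult p (p ^ a * n)) ≡⟨ cong suc (mult-^* p a n) ⟩
  suc a + mult p n         ∎

mult-*-∤ : ∀ {p q} → Prime p → ¬ p ∣ q → ∀ n → mult p (q * n) ≡ mult p n
mult-*-∤ {p} {q} pr p∤q n = go n (<-wellFounded n)
  where
  instance
    p-nonTrivial : NonTrivial p
    p-nonTrivial = prime⇒nonTrivial pr
  q-nonZero : NonZero q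
  q-nonZero = ≢-nonZero λ { refl → p∤q (p ∣0) }
  go : ∀ n → Acc _<_ n → mult p (q * n) ≡ mult p n
  go n (acc rec) with p ∣? n
  ... | no p∤n = trans (mult-∤ p p∤qn) (sym (mult-∤ p p∤n))
    where p∤qn = λ p∣qn → [ p∤q , p∤n ]′ (euclidsLemma q n pr p∣qn)
  ... | yes (divides zero    refl) = cong (mult p) (*-zeroʳ q)
  ... | yes (divides m@(suc _) refl) = begin
    mult p (q * (m * p))  ≡⟨ cong (mult p) (swap q m p) ⟩
    mult p (p * (q * m))  ≡⟨ mult-p* p (q * m) {{m*n≢0 q m {{q-nonZero}}}} ⟩
    suc (mult p (q * m))  ≡⟨ cong suc (go m (rec (m<m*n m p (nonTrivial⇒n>1 p)))) ⟩
    suc (mult p m)        ≡⟨ mult-p* p m ⟨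
    mult p (p * m)        ≡⟨ cong (mult p) (*-comm p m) ⟩
    mult p (m * p)        ∎
    where
    swap : ∀ q m p → q * (m * p) ≡ p * (q * m)
    swap = solve-∀

vTerm-∣ : ∀ {n p} → Prime p → p ∣ n → vTerm n p ≡ vPrimePower p (mult p n)
vTerm-∣ {n} {p} pr p∣n rewrite dec-true (prime? p) pr | dec-true (p ∣? n) p∣n = refl

vTerm-∤ : ∀ {n p} → ¬ p ∣ n → vTerm n p ≡ 0
vTerm-∤ {n} {p} p∤n rewrite dec-false (p ∣? n) p∤n with does (prime? p)
... | true  = refl
... | false = refl

vTerm-¬prime : ∀ {n p} → ¬ Prime p → vTerm n p ≡ 0
vTerm-¬prime {n} {p} ¬pr rewrite dec-false (prime? p) ¬pr = refl

vTerm-*-∤ : ∀ {p q} n → (Prime p → ¬ p ∣ q) → vTerm (q * n) p ≡ vTerm n p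
vTerm-*-∤ {p} {q} n p∤q = byPrimality (prime? p)
  where
  byPrimality : Dec (Prime p) → vTerm (q * n) p ≡ vTerm n p
  byPrimality (no ¬pr) = trans (vTerm-¬prime ¬pr) (sym (vTerm-¬prime ¬pr))
  byPrimality (yes pr) = byDivisibility (p ∣? n)
    where
    byDivisibility : Dec (p ∣ n) → vTerm (q * n) p ≡ vTerm n p
    byDivisibility (yes p∣n) = begin
      vTerm (q * n) p                ≡⟨ vTerm-∣ pr (∣n⇒∣m*n q p∣n) ⟩
      vPrimePower p (mult p (q * n)) ≡⟨ cong (vPrimePower p) (mult-*-∤ pr (p∤q pr) n) ⟩
      vPrimePower p (mult p n)       ≡⟨ vTerm-∣ pr p∣n ⟨
      vTerm n p                      ∎
    byDivisibility (no p∤n) = trans (vTerm-∤ p∤qn) (sym (vTerm-∤ p∤n))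
      where p∤qn = λ p∣qn → [ p∤q pr , p∤n ]′ (euclidsLemma q n pr p∣qn)

sumUpTo : (ℕ → ℕ) → ℕ → ℕ
sumUpTo h n = sum (applyUpTo h n)

sumUpTo-+ : ∀ h m k → sumUpTo h (m + k) ≡ sumUpTo h m + sumUpTo (λ i → h (m + i)) k
sumUpTo-+ h zero    k = refl
sumUpTo-+ h (suc m) k = trans (cong (h 0 +_) (sumUpTo-+ (h ∘ suc) m k))
                              (sym (+-assoc (h 0) (sumUpTo (h ∘ suc) m) _))

sumUpTo-cong : ∀ {g h} → (∀ i → g i ≡ h i) → ∀ n → sumUpTo g n ≡ sumUpTo h n
sumUpTo-cong g≗h zero    = refl
sumUpTo-cong g≗h (suc n) = cong₂ _+_ (g≗h 0) (sumUpTo-cong (g≗h ∘ suc) n)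

sumUpTo-zero : ∀ {h} → (∀ i → h i ≡ 0) → ∀ n → sumUpTo h n ≡ 0
sumUpTo-zero h≗0 zero    = refl
sumUpTo-zero h≗0 (suc n) = cong₂ _+_ (h≗0 0) (sumUpTo-zero (h≗0 ∘ suc) n)

sumUpTo-extend : ∀ {h n N} → n ≤ N → (∀ i → n ≤ i → h i ≡ 0) → sumUpTo h N ≡ sumUpTo h n
sumUpTo-extend {h} {n} n≤N h≡0 with m≤n⇒∃[o]m+o≡n n≤N
... | k , refl = begin
  sumUpTo h (n + k)                                  ≡⟨ sumUpTo-+ h n k ⟩
  sumUpTo h n + sumUpTo (λ i → h (n + i)) k          ≡⟨ cong (sumUpTo h n +_) (sumUpTo-zero (λ i → h≡0 (n + i) (m≤m+n n i)) k) ⟩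
  sumUpTo h n + 0                                    ≡⟨ +-identityʳ _ ⟩
  sumUpTo h n                                        ∎

v≡sumUpTo : ∀ {n N} → 0 < n → n < N → v n ≡ ℤ.+ sumUpTo (vTerm n) N
v≡sumUpTo {n} {N} 0<n n<N = cong ℤ.+_ (begin
  foldr (λ p acc → vTerm n p + acc) 0 (upTo (suc n)) ≡⟨ foldr-map _+_ (vTerm n) 0 (upTo (suc n)) ⟨
  sum (map (vTerm n) (upTo (suc n)))                  ≡⟨ cong sum (map-upTo (vTerm n) (suc n)) ⟩
  sumUpTo (vTerm n) (suc n)                           ≡⟨ sumUpTo-extend n<N vanish ⟨
  sumUpTo (vTerm n) N                                 ∎)
  where
  vanish : ∀ p → suc n ≤ p → vTerm n p ≡ 0
  vanish p n<p = vTerm-∤ λ p∣n → <⇒≱ n<p (∣⇒≤ {{>-nonZero 0<n}} p∣n)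

sumUpTo-vTerm-4 : ∀ n → sumUpTo (vTerm n) 4 ≡ vTerm n 2 + vTerm n 3
sumUpTo-vTerm-4 n
  rewrite vTerm-¬prime {n} ¬prime[0] | vTerm-¬prime {n} ¬prime[1] = cong (vTerm n 2 +_) (+-identityʳ (vTerm n 3))

prime∣9⇒≤3 : ∀ {p} → Prime p → p ∣ 9 → p ≤ 3
prime∣9⇒≤3 pr p∣9 = [ ∣⇒≤ , ∣⇒≤ ]′ (euclidsLemma 3 3 pr p∣9)

prime∣18⇒≤3 : ∀ {p} → Prime p → p ∣ 18 → p ≤ 3
prime∣18⇒≤3 pr p∣18 = [ (λ p∣2 → ≤-trans (∣⇒≤ p∣2) (n≤1+n 2)) , prime∣9⇒≤3 pr ]′ (euclidsLemma 2 9 pr p∣18)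

prime∣81⇒≤3 : ∀ {p} → Prime p → p ∣ 81 → p ≤ 3
prime∣81⇒≤3 pr p∣81 = [ prime∣9⇒≤3 pr , prime∣9⇒≤3 pr ]′ (euclidsLemma 9 9 pr p∣81)

v[18*n]≡v[81*n] : ∀ {n} → ¬ 2 ∣ n → v (18 * n) ≡ v (81 * n)
v[18*n]≡v[81*n] {zero}      2∤n = contradiction (2 ∣0) 2∤n
v[18*n]≡v[81*n] {n@(suc _)} 2∤n = begin
  v (18 * n)                                          ≡⟨ v≡sumUpTo z<s 18n<N ⟩
  ℤ.+ sumUpTo G N                                     ≡⟨ cong ℤ.+_ (sumUpTo-+ G 4 (81 * n)) ⟩
  ℤ.+ (sumUpTo G 4 + sumUpTo (G ∘ (4 +_)) (81 * n))   ≡⟨ cong ℤ.+_ (cong₂ _+_ low-primes (sumUpTo-cong high-primes (81 * n))) ⟩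
  ℤ.+ (sumUpTo G′ 4 + sumUpTo (G′ ∘ (4 +_)) (81 * n)) ≡⟨ cong ℤ.+_ (sumUpTo-+ G′ 4 (81 * n)) ⟨
  ℤ.+ sumUpTo G′ N                                    ≡⟨ v≡sumUpTo z<s 81n<N ⟨
  v (81 * n)                                          ∎
  where
  G G′ : ℕ → ℕ
  G  = vTerm (18 * n)
  G′ = vTerm (81 * n)
  N = 4 + 81 * n
  b = mult 3 n
  18n<N : 18 * n < N
  18n<N = s≤s (≤-trans (*-monoˡ-≤ n (m≤m+n 18 63)) (m≤n+m (81 * n) 3))
  81n<N : 81 * n < N
  81n<N = s≤s (m≤n+m (81 * n) 3)
  prime[3] : Prime 3
  prime[3] = from-yes (prime? 3)

  mult-2-18n : mult 2 (18 * n) ≡ 1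
  mult-2-18n = begin
    mult 2 (18 * n)          ≡⟨ cong (mult 2) (*-assoc 2 9 n) ⟩
    mult 2 (2 ^ 1 * (9 * n)) ≡⟨ mult-^* 2 1 (9 * n) ⟩
    1 + mult 2 (9 * n)       ≡⟨ cong suc (mult-*-∤ prime[2] (from-no (2 ∣? 9)) n) ⟩
    1 + mult 2 n             ≡⟨ cong suc (mult-∤ 2 2∤n) ⟩
    1                        ∎
  mult-3-18n : mult 3 (18 * n) ≡ 2 + b
  mult-3-18n = begin
    mult 3 (18 * n)          ≡⟨ cong (mult 3) (*-assoc 9 2 n) ⟩
    mult 3 (3 ^ 2 * (2 * n)) ≡⟨ mult-^* 3 2 (2 * n) ⟩
    2 + mult 3 (2 * n)       ≡⟨ cong (2 +_) (mult-*-∤ prime[3] (from-no (3 ∣? 2)) n) ⟩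
    2 + b                    ∎

  low-primes : sumUpTo G 4 ≡ sumUpTo G′ 4
  low-primes = begin
    sumUpTo G 4     ≡⟨ sumUpTo-vTerm-4 (18 * n) ⟩
    G 2 + G 3       ≡⟨ cong₂ _+_ (trans (vTerm-∣ prime[2] (∣m⇒∣m*n n (divides 9 refl))) (cong (vPrimePower 2) mult-2-18n))
                                 (trans (vTerm-∣ prime[3] (∣m⇒∣m*n n (divides 6 refl))) (cong (vPrimePower 3) mult-3-18n)) ⟩
    7 + b           ≡⟨ cong₂ _+_ (trans (vTerm-*-∤ n (λ _ → from-no (2 ∣? 81))) (vTerm-∤ 2∤n))
                                 (trans (vTerm-∣ prime[3] (∣m⇒∣m*n n (divides 27 refl))) (cong (vPrimePower 3) (mult-^* 3 4 n))) ⟨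
    G′ 2 + G′ 3     ≡⟨ sumUpTo-vTerm-4 (81 * n) ⟨
    sumUpTo G′ 4    ∎

  above-3 : ∀ {d} → (∀ {p} → Prime p → p ∣ d → p ≤ 3) → ∀ i → Prime (4 + i) → ¬ (4 + i) ∣ d
  above-3 small i pr p∣d = <⇒≱ (s≤s (s≤s (s≤s (s≤s z≤n)))) (small pr p∣d)

  high-primes : ∀ i → G (4 + i) ≡ G′ (4 + i)
  high-primes i = trans (vTerm-*-∤ n (above-3 prime∣18⇒≤3 i)) (sym (vTerm-*-∤ n (above-3 prime∣81⇒≤3 i)))

∤-+-multiple : ∀ {d a} x → ¬ d ∣ a → ¬ d ∣ a + d * x
∤-+-multiple {d} {a} x d∤a d∣a+dx = d∤a (∣m+n∣m⇒∣n (subst (d ∣_) (+-comm a (d * x)) d∣a+dx) (m∣m*n x))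

theorem5p1 : (ρ : ℕ) → 1 ≤ ρ → r ρ ≡ ρ → DigitsZeroOne ρ → IsVPalindrome (18 * ρ)
theorem5p1 ρ 1≤ρ rρ≡ρ bits = 10∤18ρ , 18ρ≢r18ρ , trans (v[18*n]≡v[81*n] 2∤ρ) (cong v (sym r18ρ≡81ρ))
  where
  q = proj₁ (r≡1+10* 1≤ρ bits)
  ρ≡1+10q : ρ ≡ 1 + 10 * q
  ρ≡1+10q = trans (sym rρ≡ρ) (proj₂ (r≡1+10* 1≤ρ bits))
  r18ρ≡81ρ : r (18 * ρ) ≡ 81 * ρ
  r18ρ≡81ρ = trans (r-18* ρ bits) (cong (81 *_) rρ≡ρ)
  2∤ρ : ¬ 2 ∣ ρ
  2∤ρ = subst (λ m → ¬ 2 ∣ m) (sym (trans ρ≡1+10q (cong suc (*-assoc 2 5 q)))) (∤-+-multiple (5 * q) (from-no (2 ∣? 1)))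
  10∤18ρ : ¬ 10 ∣ 18 * ρ
  10∤18ρ = subst (λ m → ¬ 10 ∣ m) (sym (trans (cong (18 *_) ρ≡1+10q) (shift q))) (∤-+-multiple (1 + 18 * q) (from-no (10 ∣? 8)))
    where
    shift : ∀ q → 18 * (1 + 10 * q) ≡ 8 + 10 * (1 + 18 * q)
    shift = solve-∀
  18ρ≢r18ρ : 18 * ρ ≢ r (18 * ρ)
  18ρ≢r18ρ eq with () ← *-cancelʳ-≡ 18 81 ρ {{>-nonZero 1≤ρ}} (trans eq r18ρ≡81ρ)
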